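{- For every $k\in\mathbb{N}=\{1,2,\dots\}$: (1) if $k$ is the largest element of a finite set $S\subseteq\mathbb{N}$, then $C_S=(\alpha_{k-1}+2)\,C_{S\setminus\{k\}}$; (2) $\alpha_k=\sum_{j=1}^kC_{[k]\setminus\{j\}}=C_{[k]}-1$; (3) $C_{[k]\setminus\{1\}}>C_{[k]\setminus\{2\}}>\cdots>C_{[k]\setminus\{k-1\}}>C_{[k]\setminus\{k\}}$.
   Context: Write $[m]=\{1,\dots,m\}$ ($[0]=\emptyset$). The constants $C_S$ for finite $S\subseteq\mathbb{N}$ are defined by $C_\emptyset=1$ and, for $S\ne\emptyset$, $C_S=1+\sum_{j\in S}C_{(S\setminus\{j\})\cup[j-1]}$ (well defined by induction in the co-lex order: $S$ precedes $T$ if there is $i\in T\setminus S$ such that $S$ and $T$ agree on membership of all integers greater than $i$). The numbers $\alpha_k$ are defined by $\alpha_0=0$ and $\alpha_k=\alpha_{k-1}^2+3\alpha_{k-1}+1$ for $k\ge1$. -}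

module Defs where

open import Data.Nat using (ℕ; zero; suc; _+_; _*_; _^_; _<ᵇ_)
open import Data.Bool using (Bool; true; false; _∨_; _∧_; if_then_else_)
open import Data.Fin using (Fin; toℕ)
open import Data.Fin.Subset using (Subset)
open import Data.List using (List; map; allFin)
open import Data.Nat.ListAction using (sum)
open import Data.Vec using (lookup; tabulate)

-- A finite set S ⊆ {1,…,n} is encoded as  S : Subset n  (= Vec Bool n);
-- the position  i : Fin n  stands for the positive integer  toℕ i + 1.

-- (S \ {j}) ∪ [j-1]  : positions below j become members, j is removed,
-- positions above j keep their membership.
step : ∀ {n} → Subset n → Fin n → Subset n
step S j = tabulate λ i → (toℕ i <ᵇ toℕ j) ∨ (lookup S i ∧ (toℕ j <ᵇ toℕ i))

-- Fuel-bounded evaluation of the recursion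
--   C_S = 1 + Σ_{j ∈ S} C_{(S\{j}) ∪ [j-1]} ,   C_∅ = 1.
-- Each step strictly decreases the binary value Σ_{i∈S} 2^(i-1) < 2^n,
-- so fuel 2^n is always enough (fuel 0 is only reached at S = ∅, where 1 is correct).
C-fuel : ∀ {n} → ℕ → Subset n → ℕ
C-fuel zero    S = 1
C-fuel {n} (suc f) S =
  suc (sum (map (λ j → if lookup S j then C-fuel f (step S j) else 0) (allFin n)))

C : ∀ {n} → Subset n → ℕ
C {n} S = C-fuel (2 ^ n) S

α : ℕ → ℕ
α zero    = 0
α (suc k) = α k * α k + 3 * α k + 1

module Submission where

-- The recursion defining C has an explicit solution: C_S is the
-- product, over the members i ∈ S, of the factors α_{i-1} + 2.  More
-- generally, reading the positions of S as the integers o+1, o+2, …, the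
-- product  weight o S = ∏_{i∈S} (α_{o+i-1} + 2)  satisfies
--     weight o S = 1 + (α_o + 1) · Σ_{j∈S} weight o (step S j),
-- which for o = 0 (α_0 + 1 = 1) is exactly the recursion for C.  This follows
-- by induction on S from α_{o+1} + 1 = (α_o + 1)(α_o + 2).

open import Defs
open import Data.Nat using (ℕ; zero; suc; _+_; _*_; _∸_; _^_; _<_; _≤_; z≤n; s≤s; NonZero)
open import Data.Nat.Properties
open import Data.Nat.Tactic.RingSolver using (solve-∀)
open import Algebra.Properties.CommutativeSemigroup *-commutativeSemigroup using (x∙yz≈y∙xz)
open import Data.Nat.ListAction using (sum)
open import Data.Bool using (Bool; true; false; if_then_else_; _∧_)
open import Data.Bool.Properties using (∧-identityʳ)
open import Data.Fin using (Fin; toℕ; fromℕ) renaming (zero to fzero; suc to fsuc)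
open import Data.Fin.Subset using (Subset; ⊤; ⊥; _∈_; _─_; ⁅_⁆)
open import Data.Vec using ([]; _∷_; lookup; here; there)
import Data.Vec.Properties as Vec
open import Data.List using (map; allFin)
import Data.List.Properties as List
open import Data.Product using (_×_; _,_)
open import Relation.Binary.PropositionalEquality
  using (_≡_; refl; sym; trans; cong; cong₂; subst; module ≡-Reasoning)

α-suc : ∀ k → α (suc k) + 1 ≡ (α k + 1) * (α k + 2)
α-suc k = identity (α k)
  where
  identity : ∀ a → a * a + 3 * a + 1 + 1 ≡ (a + 1) * (a + 2)
  identity = solve-∀

α-< : ∀ k → α k < α (suc k)
α-< k = subst (α k <_) (identity (α k)) (s≤s (m≤m+n (α k) (α k * α k + 2 * α k)))
  where
  identity : ∀ a → suc (a + (a * a + 2 * a)) ≡ a * a + 3 * a + 1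
  identity = solve-∀

-- The factors α_o + 2 are nonzero (needed to multiply strict inequalities).
factor-nonZero : ∀ a → NonZero (a + 2)
factor-nonZero zero    = _
factor-nonZero (suc a) = _

-- Member sums  Σ_{j∈S} h j , written exactly as in the definition of C.
memberSum : ∀ {n} → Subset n → (Fin n → ℕ) → ℕ
memberSum {n} S h = sum (map (λ j → if lookup S j then h j else 0) (allFin n))

memberSum-∷ : ∀ {n} b (S : Subset n) (h : Fin (suc n) → ℕ) →
  memberSum (b ∷ S) h ≡ (if b then h fzero else 0) + memberSum S (λ j → h (fsuc j))
memberSum-∷ {n} b S h = begin
  sum (map g (allFin (suc n)))          ≡⟨ cong sum (List.map-tabulate (λ j → j) g) ⟩
  g fzero + sum (Data.List.tabulate (λ j → g (fsuc j)))
    ≡⟨ cong (λ xs → g fzero + sum xs) (sym (List.map-tabulate (λ j → j) (λ j → g (fsuc j)))) ⟩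
  g fzero + memberSum S (λ j → h (fsuc j)) ∎
  where
  open ≡-Reasoning
  g : Fin (suc n) → ℕ
  g j = if lookup (b ∷ S) j then h j else 0

memberSum-scale : ∀ {n} (S : Subset n) k (h : Fin n → ℕ) →
  memberSum S (λ j → k * h j) ≡ k * memberSum S h
memberSum-scale []      k h = sym (*-zeroʳ k)
memberSum-scale (b ∷ S) k h = begin
  memberSum (b ∷ S) (λ j → k * h j)
    ≡⟨ memberSum-∷ b S (λ j → k * h j) ⟩
  (if b then k * h fzero else 0) + memberSum S (λ j → k * h (fsuc j))
    ≡⟨ cong₂ _+_ (if-scale b) (memberSum-scale S k (λ j → h (fsuc j))) ⟩
  k * (if b then h fzero else 0) + k * memberSum S (λ j → h (fsuc j))
    ≡⟨ sym (*-distribˡ-+ k _ _) ⟩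
  k * ((if b then h fzero else 0) + memberSum S (λ j → h (fsuc j)))
    ≡⟨ cong (k *_) (sym (memberSum-∷ b S h)) ⟩
  k * memberSum (b ∷ S) h ∎
  where
  open ≡-Reasoning
  if-scale : ∀ b → (if b then k * h fzero else 0) ≡ k * (if b then h fzero else 0)
  if-scale true  = refl
  if-scale false = sym (*-zeroʳ k)

memberSum-cong : ∀ {n} (S : Subset n) {h h′ : Fin n → ℕ} →
  (∀ j → lookup S j ≡ true → h j ≡ h′ j) → memberSum S h ≡ memberSum S h′
memberSum-cong {n} S {h} {h′} agree = cong sum (List.map-cong pointwise (allFin n))
  where
  pointwise : ∀ j → (if lookup S j then h j else 0) ≡ (if lookup S j then h′ j else 0)
  pointwise j with lookup S j in member
  ... | true  = agree j member
  ... | false = refl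

memberSum-⊤ : ∀ {n} (h : Fin n → ℕ) → memberSum ⊤ h ≡ sum (map h (allFin n))
memberSum-⊤ {n} h = cong sum (List.map-cong full (allFin n))
  where
  full : ∀ j → (if lookup (⊤ {n}) j then h j else 0) ≡ h j
  full j = cong (λ b → if b then h j else 0) (Vec.lookup-replicate j true)

-- The tail of  step (b ∷ S) fzero  rebuilds S; step S j = (S ∖ {j}) ∪ [j-1].
tabulate-lookup-∧-true : ∀ {n} (S : Subset n) →
  Data.Vec.tabulate (λ i → lookup S i ∧ true) ≡ S
tabulate-lookup-∧-true S =
  trans (Vec.tabulate-cong (λ i → ∧-identityʳ (lookup S i))) (Vec.tabulate∘lookup S)

step-head : ∀ {n} b (S : Subset n) → step (b ∷ S) fzero ≡ false ∷ S
step-head true  S = cong (false ∷_) (tabulate-lookup-∧-true S)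
step-head false S = cong (false ∷_) (tabulate-lookup-∧-true S)

-- On the full set, step just removes j.  (For a later position,
-- step (b ∷ S) (fsuc j) = true ∷ step S j  holds definitionally.)
step-⊤ : ∀ {n} (j : Fin n) → step ⊤ j ≡ ⊤ ─ ⁅ j ⁆
step-⊤ {suc n} fzero    = trans (step-head true ⊤) (cong (false ∷_) (sym ⊤─⊥))
  where
  ⊤─⊥ : ∀ {n} → ⊤ {n} ─ ⊥ ≡ ⊤
  ⊤─⊥ {zero}  = refl
  ⊤─⊥ {suc n} = cong (true ∷_) ⊤─⊥
step-⊤ {suc n} (fsuc j) = cong (true ∷_) (step-⊤ j)

-- weight o S = ∏_{i∈S} (α_{o+i-1} + 2), positions of S counted from o+1.
weight : ∀ {n} → ℕ → Subset n → ℕ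
weight o []      = 1
weight o (b ∷ S) = (if b then α o + 2 else 1) * weight (suc o) S

weight-recurrence : ∀ {n} o (S : Subset n) →
  weight o S ≡ suc ((α o + 1) * memberSum S (λ j → weight o (step S j)))
weight-recurrence o [] = cong suc (sym (*-zeroʳ (α o + 1)))
weight-recurrence o (b ∷ S) = begin
  weight o (b ∷ S)
    ≡⟨ closed-form b (weight (suc o) S) (weight-recurrence (suc o) S) ⟩
  suc ((α o + 1) * ((if b then weight (suc o) S else 0) + (α o + 2) * G))
    ≡⟨ cong (λ x → suc ((α o + 1) * x)) (sym split) ⟩
  suc ((α o + 1) * memberSum (b ∷ S) (λ j → weight o (step (b ∷ S) j))) ∎
  where
  open ≡-Reasoning
  c : Bool → ℕ
  c b = if b then α o + 2 else 1
  G : ℕ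
  G = memberSum S (λ j → weight (suc o) (step S j))
  split : memberSum (b ∷ S) (λ j → weight o (step (b ∷ S) j))
        ≡ (if b then weight (suc o) S else 0) + (α o + 2) * G
  split = begin
    memberSum (b ∷ S) (λ j → weight o (step (b ∷ S) j))
      ≡⟨ memberSum-∷ b S _ ⟩
    (if b then weight o (step (b ∷ S) fzero) else 0)
      + memberSum S (λ j → (α o + 2) * weight (suc o) (step S j))
      ≡⟨ cong₂ (λ T x → (if b then weight o T else 0) + x)
               (step-head b S) (memberSum-scale S (α o + 2) _) ⟩
    (if b then 1 * weight (suc o) S else 0) + (α o + 2) * G
      ≡⟨ cong (λ x → (if b then x else 0) + (α o + 2) * G) (*-identityˡ _) ⟩
    (if b then weight (suc o) S else 0) + (α o + 2) * G ∎
  -- with a = α_o and α_{o+1} = a² + 3a + 1 this is ring arithmetic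
  closed-form : ∀ b w → w ≡ suc ((α (suc o) + 1) * G) →
    c b * w ≡ suc ((α o + 1) * ((if b then w else 0) + (α o + 2) * G))
  closed-form true  _ refl = arith-in (α o) G
    where
    arith-in : ∀ a g → (a + 2) * suc ((a * a + 3 * a + 1 + 1) * g)
      ≡ suc ((a + 1) * (suc ((a * a + 3 * a + 1 + 1) * g) + (a + 2) * g))
    arith-in = solve-∀
  closed-form false _ refl = arith-out (α o) G
    where
    arith-out : ∀ a g → 1 * suc ((a * a + 3 * a + 1 + 1) * g)
      ≡ suc ((a + 1) * (0 + (a + 2) * g))
    arith-out = solve-∀

weight-nonZero : ∀ {n} o (S : Subset n) → NonZero (weight o S)
weight-nonZero o S rewrite weight-recurrence o S = _

-- The fuel 2^n in the definition of C suffices.  The binary code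
-- code S = Σ_{i∈S} 2^(i-1) is below 2^n and strictly drops at every step,
-- since step S j trades the bit of j for the lower bits only.
code : ∀ {n} → Subset n → ℕ
code []      = 0
code (b ∷ S) = (if b then 1 else 0) + 2 * code S

code-< : ∀ {n} (S : Subset n) → code S < 2 ^ n
code-< [] = s≤s z≤n
code-< {suc n} (b ∷ S) = begin-strict
  bit b + 2 * code S   <⟨ s≤s (+-monoˡ-≤ (2 * code S) (bit≤1 b)) ⟩
  2 + 2 * code S       ≡⟨ sym (*-suc 2 (code S)) ⟩
  2 * suc (code S)     ≤⟨ *-monoʳ-≤ 2 (code-< S) ⟩
  2 * 2 ^ n            ∎
  where
  open ≤-Reasoning
  bit : Bool → ℕ
  bit b = if b then 1 else 0
  bit≤1 : ∀ b → bit b ≤ 1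
  bit≤1 true  = s≤s z≤n
  bit≤1 false = z≤n

code-step : ∀ {n} (S : Subset n) j → lookup S j ≡ true → code (step S j) < code S
code-step (true ∷ S) fzero _ rewrite tabulate-lookup-∧-true S = n<1+n (2 * code S)
code-step (b ∷ S) (fsuc j) member = begin-strict
  suc (2 * code (step S j))   <⟨ n<1+n _ ⟩
  2 + 2 * code (step S j)     ≡⟨ sym (*-suc 2 (code (step S j))) ⟩
  2 * suc (code (step S j))   ≤⟨ *-monoʳ-≤ 2 (code-step S j member) ⟩
  2 * code S                  ≤⟨ m≤n+m (2 * code S) (if b then 1 else 0) ⟩
  code (b ∷ S)                ∎
  where open ≤-Reasoning

fuel-sufficient : ∀ f {n} (S : Subset n) → code S < f → C-fuel f S ≡ weight 0 S
fuel-sufficient (suc f) S (s≤s code≤f) = begin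
  suc (memberSum S (λ j → C-fuel f (step S j)))
    ≡⟨ cong suc (memberSum-cong S agree) ⟩
  suc (memberSum S (λ j → weight 0 (step S j)))
    ≡⟨ cong suc (sym (*-identityˡ _)) ⟩
  suc (1 * memberSum S (λ j → weight 0 (step S j)))
    ≡⟨ sym (weight-recurrence 0 S) ⟩
  weight 0 S ∎
  where
  open ≡-Reasoning
  agree : ∀ j → lookup S j ≡ true → C-fuel f (step S j) ≡ weight 0 (step S j)
  agree j member = fuel-sufficient f (step S j) (≤-trans (code-step S j member) code≤f)

C≡weight : ∀ {n} (S : Subset n) → C S ≡ weight 0 S
C≡weight S = fuel-sufficient _ S (code-< S)

weight-top : ∀ m o (S : Subset (suc m)) → fromℕ m ∈ S →
  weight o S ≡ (α (o + m) + 2) * weight o (S ─ ⁅ fromℕ m ⁆)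
weight-top zero    o (true ∷ []) here rewrite +-identityʳ o = refl
weight-top (suc m) o (b ∷ S) (there top∈S)
  rewrite +-suc o m | weight-top m (suc o) S top∈S =
  x∙yz≈y∙xz (if b then α o + 2 else 1) (α (suc (o + m)) + 2) _

weight-⊤ : ∀ n o → (α o + 1) * weight o (⊤ {n}) ≡ α (o + n) + 1
weight-⊤ zero    o rewrite +-identityʳ o = *-identityʳ (α o + 1)
weight-⊤ (suc n) o = begin
  (α o + 1) * ((α o + 2) * W)  ≡⟨ sym (*-assoc (α o + 1) (α o + 2) W) ⟩
  (α o + 1) * (α o + 2) * W    ≡⟨ cong (_* W) (sym (α-suc o)) ⟩
  (α (suc o) + 1) * W          ≡⟨ weight-⊤ n (suc o) ⟩
  α (suc o + n) + 1            ≡⟨ cong (λ k → α k + 1) (sym (+-suc o n)) ⟩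
  α (o + suc n) + 1            ∎
  where
  open ≡-Reasoning
  W : ℕ
  W = weight (suc o) (⊤ {n})

-- Omitting the second position instead of the first trades the factor
-- α_{o+1} + 2 for the smaller α_o + 2.
weight-swap : ∀ {n} o (R : Subset n) →
  weight o (true ∷ false ∷ R) < weight o (false ∷ true ∷ R)
weight-swap o R = begin-strict
  (α o + 2) * (1 * W)          ≡⟨ cong ((α o + 2) *_) (*-identityˡ W) ⟩
  (α o + 2) * W                <⟨ *-monoˡ-< W {{weight-nonZero (suc (suc o)) R}} (+-monoˡ-< 2 (α-< o)) ⟩
  (α (suc o) + 2) * W          ≡⟨ sym (*-identityˡ _) ⟩
  1 * ((α (suc o) + 2) * W)    ∎
  where
  open ≤-Reasoning
  W : ℕ
  W = weight (suc (suc o)) R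

weight-shift : ∀ {n} o (i j : Fin n) → suc (toℕ i) ≡ toℕ j →
  weight o (⊤ ─ ⁅ j ⁆) < weight o (⊤ ─ ⁅ i ⁆)
weight-shift {suc (suc n)} o fzero (fsuc fzero) _ = weight-swap o (⊤ {n} ─ ⊥)
weight-shift o fzero (fsuc (fsuc j)) ()
weight-shift o (fsuc i) (fsuc j) eq =
  *-monoʳ-< (α o + 2) {{factor-nonZero (α o)}} (weight-shift (suc o) i j (suc-injective eq))

C-⊤ : ∀ k → C (⊤ {k}) ≡ α k + 1
C-⊤ k = trans (C≡weight (⊤ {k})) (trans (sym (*-identityˡ _)) (weight-⊤ k 0))

-- α_k = Σ_{j∈[k]} C_{[k]∖{j}}: the recursion for C_{[k]} combined with C-⊤.
α-sum : ∀ k → α k ≡ sum (map (λ j → C (⊤ ─ ⁅ j ⁆)) (allFin k))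
α-sum k = suc-injective (begin
  suc (α k)                                      ≡⟨ +-comm 1 (α k) ⟩
  α k + 1                                        ≡⟨ sym (C-⊤ k) ⟩
  C [k]                                          ≡⟨ C≡weight [k] ⟩
  weight 0 [k]                                   ≡⟨ weight-recurrence 0 [k] ⟩
  suc (1 * memberSum [k] (λ j → weight 0 (step [k] j)))
    ≡⟨ cong suc (*-identityˡ _) ⟩
  suc (memberSum [k] (λ j → weight 0 (step [k] j)))
    ≡⟨ cong suc (memberSum-cong [k] (λ j _ → removal j)) ⟩
  suc (memberSum [k] (λ j → C ([k] ─ ⁅ j ⁆)))
    ≡⟨ cong suc (memberSum-⊤ (λ j → C ([k] ─ ⁅ j ⁆))) ⟩
  suc (sum (map (λ j → C ([k] ─ ⁅ j ⁆)) (allFin k))) ∎)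
  where
  open ≡-Reasoning
  [k] : Subset k
  [k] = ⊤
  removal : ∀ j → weight 0 (step [k] j) ≡ C ([k] ─ ⁅ j ⁆)
  removal j = trans (cong (weight 0) (step-⊤ j)) (sym (C≡weight ([k] ─ ⁅ j ⁆)))

lemma7 : (m : ℕ) →
    ((S : Subset (suc m)) → fromℕ m ∈ S →
        C S ≡ (α m + 2) * C (S ─ ⁅ fromℕ m ⁆))
    × (α (suc m) ≡ sum (map (λ j → C (⊤ ─ ⁅ j ⁆)) (allFin (suc m))))
    × (α (suc m) ≡ C (⊤ {suc m}) ∸ 1)
    × ((i j : Fin (suc m)) → suc (toℕ i) ≡ toℕ j →
        C (⊤ ─ ⁅ j ⁆) < C (⊤ ─ ⁅ i ⁆))
lemma7 m = top-factor , α-sum (suc m) , α-as-C , decreasing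
  where
  top-factor : (S : Subset (suc m)) → fromℕ m ∈ S → C S ≡ (α m + 2) * C (S ─ ⁅ fromℕ m ⁆)
  top-factor S top∈S rewrite C≡weight S | C≡weight (S ─ ⁅ fromℕ m ⁆) = weight-top m 0 S top∈S
  α-as-C : α (suc m) ≡ C (⊤ {suc m}) ∸ 1
  α-as-C rewrite C-⊤ (suc m) = sym (m+n∸n≡m (α (suc m)) 1)
  decreasing : (i j : Fin (suc m)) → suc (toℕ i) ≡ toℕ j → C (⊤ ─ ⁅ j ⁆) < C (⊤ ─ ⁅ i ⁆)
  decreasing i j next rewrite C≡weight (⊤ {suc m} ─ ⁅ j ⁆) | C≡weight (⊤ {suc m} ─ ⁅ i ⁆) =
    weight-shift 0 i j next
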